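{- For $M,N\in\Lambda$ and $A\in\mathcal A$, if $A\sqsubseteq M$ and $M\to_{\mathsf v}N$ then $A\sqsubseteq N$.
   Context: Call-by-value $\lambda$-calculus: $\Lambda$ is the set of $\lambda$-terms $M::=x\mid\lambda x.M\mid MN$ up to $\alpha$-conversion; values are variables and abstractions. Reductions: $(\beta_v)$ $(\lambda x.M)V\to M\{V/x\}$ for $V$ a value; $(\sigma_1)$ $(\lambda x.M)NP\to(\lambda x.MP)N$ if $x\notin FV(P)$; $(\sigma_3)$ $V((\lambda x.M)N)\to(\lambda x.VM)N$ if $V$ value, $x\notin FV(V)$. $\to_{\mathsf v}$ is the contextual closure of their union. $\Lambda_\bot$: $\lambda$-terms possibly containing a constant $\bot$; $\sqsubseteq$ is the context-closed preorder on $\Lambda_\bot$ generated by $\bot\sqsubseteq x$ and $\bot\sqsubseteq\lambda x.M$. Approximants $\mathcal A$: $A::=B\mid C$; $B::=x\mid\lambda x.A\mid\bot\mid xBA_1\cdots A_k$; $C::=(\lambda x.A)(yBA_1\cdots A_k)$ ($k\ge0$). -}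

module Defs where

open import Data.Nat using (ℕ; zero; suc)
open import Data.Fin using (Fin; zero; suc)

-- Well-scoped de Bruijn terms of Λ_⊥ with n free variables (α-conversion is built in).
infixl 7 _·_
data Term (n : ℕ) : Set where
  var : Fin n → Term n
  lam : Term (suc n) → Term n
  _·_ : Term n → Term n → Term n
  bot : Term n

data InΛ {n : ℕ} : Term n → Set where
  var : (x : Fin n) → InΛ (var x)
  lam : {M : Term (suc n)} → InΛ M → InΛ (lam M)
  app : {M N : Term n} → InΛ M → InΛ N → InΛ (M · N)

data Value {n : ℕ} : Term n → Set where
  var : (x : Fin n) → Value (var x)
  lam : (M : Term (suc n)) → Value (lam M)

Ren : ℕ → ℕ → Set
Ren m n = Fin m → Fin n

liftRen : ∀ {m n} → Ren m n → Ren (suc m) (suc n)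
liftRen ρ zero    = zero
liftRen ρ (suc x) = suc (ρ x)

rename : ∀ {m n} → Ren m n → Term m → Term n
rename ρ (var x) = var (ρ x)
rename ρ (lam M) = lam (rename (liftRen ρ) M)
rename ρ (M · N) = rename ρ M · rename ρ N
rename ρ bot     = bot

weaken : ∀ {n} → Term n → Term (suc n)
weaken = rename suc

Sub : ℕ → ℕ → Set
Sub m n = Fin m → Term n

liftSub : ∀ {m n} → Sub m n → Sub (suc m) (suc n)
liftSub σ zero    = var zero
liftSub σ (suc x) = weaken (σ x)

subst : ∀ {m n} → Sub m n → Term m → Term n
subst σ (var x) = σ x
subst σ (lam M) = lam (subst (liftSub σ) M)
subst σ (M · N) = subst σ M · subst σ N
subst σ bot     = bot

single : ∀ {n} → Term n → Sub (suc n) n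
single V zero    = V
single V (suc x) = var x

_[_] : ∀ {n} → Term (suc n) → Term n → Term n
M [ V ] = subst (single V) M

-- Call-by-value reduction →v: contextual closure of βv, σ1, σ3.
-- The side conditions x ∉ FV(P), x ∉ FV(V) are expressed by P, V being
-- weakened into the scope of the binder.
infix 4 _→v_
data _→v_ {n : ℕ} : Term n → Term n → Set where
  βv   : ∀ {M V} → Value V → (lam M · V) →v M [ V ]
  σ1   : ∀ {M N P} → (lam M · N · P) →v (lam (M · weaken P) · N)
  σ3   : ∀ {V M N} → Value V → (V · (lam M · N)) →v (lam (weaken V · M) · N)
  ξlam : ∀ {M M'} → M →v M' → lam M →v lam M'
  ξl   : ∀ {M M' N} → M →v M' → M · N →v M' · N
  ξr   : ∀ {M N N'} → N →v N' → M · N →v M · N'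

infix 4 _⊑_
data _⊑_ {n : ℕ} : Term n → Term n → Set where
  ⊑-refl  : ∀ {M} → M ⊑ M
  ⊑-trans : ∀ {M N P} → M ⊑ N → N ⊑ P → M ⊑ P
  ⊑-var   : ∀ {x} → bot ⊑ var x
  ⊑-lam   : ∀ {M} → bot ⊑ lam M
  ⊑-ξlam  : ∀ {M M'} → M ⊑ M' → lam M ⊑ lam M'
  ⊑-ξl    : ∀ {M M' N} → M ⊑ M' → M · N ⊑ M' · N
  ⊑-ξr    : ∀ {M N N'} → N ⊑ N' → M · N ⊑ M · N'

-- Approximants:
--   A ::= B | C
--   B ::= x | λx.A | ⊥ | x B A1 ... Ak
--   C ::= (λx.A)(y B A1 ... Ak)            (k ≥ 0)
-- Spine t  means  t = x B A1 ... Ak.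
mutual
  data IsA {n : ℕ} : Term n → Set where
    fromB : ∀ {t} → IsB t → IsA t
    fromC : ∀ {t} → IsC t → IsA t

  data IsB {n : ℕ} : Term n → Set where
    var   : (x : Fin n) → IsB (var x)
    lam   : ∀ {A} → IsA A → IsB (lam A)
    bot   : IsB bot
    spine : ∀ {t} → Spine t → IsB t

  data IsC {n : ℕ} : Term n → Set where
    redex : ∀ {A t} → IsA A → Spine t → IsC (lam A · t)

  data Spine {n : ℕ} : Term n → Set where
    head : (x : Fin n) → ∀ {B} → IsB B → Spine (var x · B)
    arg  : ∀ {t A} → Spine t → IsA A → Spine (t · A)

-- The preorder ⊑ coincides with its syntax-directed presentation ≼, in which A ≼ M
-- means that M is obtained from A by replacing some occurrences of ⊥ by values.
-- A spine x B A₁ … Aₖ never approximates a value and an approximant of the form B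
-- never approximates an application of an abstraction; from the grammar of
-- approximants it follows that no approximant approximates a βv-, σ1- or σ3-redex.
-- Hence a step M →v N happens either inside a value that replaced a ⊥ of A, where A
-- does not see it, or inside a subterm approximated by a smaller approximant.
module Submission where

open import Defs
open import Data.Nat using (ℕ; suc)
open import Data.Product using (_×_; _,_; proj₁; proj₂)
open import Data.Empty using (⊥; ⊥-elim)

infix 4 _≼_
data _≼_ {n : ℕ} : Term n → Term n → Set where
  ≼-bot     : bot ≼ bot
  ≼-bot-var : ∀ {x} → bot ≼ var x
  ≼-bot-lam : ∀ {M} → bot ≼ lam M
  ≼-var     : ∀ {x} → var x ≼ var x
  ≼-lam     : ∀ {M M'} → M ≼ M' → lam M ≼ lam M'
  ≼-app     : ∀ {M M' N N'} → M ≼ M' → N ≼ N' → M · N ≼ M' · N'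

≼-refl : ∀ {n} (M : Term n) → M ≼ M
≼-refl (var x) = ≼-var
≼-refl (lam M) = ≼-lam (≼-refl M)
≼-refl (M · N) = ≼-app (≼-refl M) (≼-refl N)
≼-refl bot     = ≼-bot

≼-trans : ∀ {n} {M N P : Term n} → M ≼ N → N ≼ P → M ≼ P
≼-trans ≼-bot       q           = q
≼-trans ≼-bot-var   ≼-var       = ≼-bot-var
≼-trans ≼-bot-lam   (≼-lam _)   = ≼-bot-lam
≼-trans ≼-var       q           = q
≼-trans (≼-lam p)   (≼-lam q)   = ≼-lam (≼-trans p q)
≼-trans (≼-app p r) (≼-app q s) = ≼-app (≼-trans p q) (≼-trans r s)

⊑⇒≼ : ∀ {n} {M N : Term n} → M ⊑ N → M ≼ N
⊑⇒≼ {M = M}     ⊑-refl        = ≼-refl M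
⊑⇒≼             (⊑-trans p q) = ≼-trans (⊑⇒≼ p) (⊑⇒≼ q)
⊑⇒≼             ⊑-var         = ≼-bot-var
⊑⇒≼             ⊑-lam         = ≼-bot-lam
⊑⇒≼             (⊑-ξlam p)    = ≼-lam (⊑⇒≼ p)
⊑⇒≼ {M = _ · N} (⊑-ξl p)      = ≼-app (⊑⇒≼ p) (≼-refl N)
⊑⇒≼ {M = M · _} (⊑-ξr p)      = ≼-app (≼-refl M) (⊑⇒≼ p)

≼⇒⊑ : ∀ {n} {M N : Term n} → M ≼ N → M ⊑ N
≼⇒⊑ ≼-bot       = ⊑-refl
≼⇒⊑ ≼-bot-var   = ⊑-var
≼⇒⊑ ≼-bot-lam   = ⊑-lam
≼⇒⊑ ≼-var       = ⊑-refl
≼⇒⊑ (≼-lam p)   = ⊑-ξlam (≼⇒⊑ p)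
≼⇒⊑ (≼-app p q) = ⊑-trans (⊑-ξl (≼⇒⊑ p)) (⊑-ξr (≼⇒⊑ q))

IsA-lam⁻ : ∀ {n} {A : Term (suc n)} → IsA (lam A) → IsA A
IsA-lam⁻ (fromB (lam a)) = a

IsA-app⁻ : ∀ {n} {A₁ A₂ : Term n} → IsA (A₁ · A₂) → IsB A₁ × IsA A₂
IsA-app⁻ (fromB (spine (head x b))) = var x , fromB b
IsA-app⁻ (fromB (spine (arg s a)))  = spine s , a
IsA-app⁻ (fromC (redex a s))        = lam a , fromB (spine s)

Spine-⋠-value : ∀ {n} {t V : Term n} → Spine t → Value V → t ≼ V → ⊥
Spine-⋠-value (head x b) (var _) ()
Spine-⋠-value (head x b) (lam _) ()
Spine-⋠-value (arg s a)  (var _) ()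
Spine-⋠-value (arg s a)  (lam _) ()

IsB-⋠-redex : ∀ {n} {B N : Term n} {M} → IsB B → B ≼ lam M · N → ⊥
IsB-⋠-redex (spine (head x b)) (≼-app () _)
IsB-⋠-redex (spine (arg s _))  (≼-app p _) = Spine-⋠-value s (lam _) p

IsA-⋠-βv-redex : ∀ {n} {A V : Term n} {M} → IsA A → Value V → A ≼ lam M · V → ⊥
IsA-⋠-βv-redex (fromB b)           _ p           = IsB-⋠-redex b p
IsA-⋠-βv-redex (fromC (redex _ s)) v (≼-app _ q) = Spine-⋠-value s v q

IsA-⋠-σ3-redex : ∀ {n} {A V : Term n} {M N} → IsA A → Value V → A ≼ V · (lam M · N) → ⊥
IsA-⋠-σ3-redex (fromB (spine (head _ b))) _ (≼-app _ q) = IsB-⋠-redex b q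
IsA-⋠-σ3-redex (fromB (spine (arg s _)))  v (≼-app p _) = Spine-⋠-value s v p
IsA-⋠-σ3-redex (fromC (redex _ s))        _ (≼-app _ q) = IsB-⋠-redex (spine s) q

IsA-≼-→v : ∀ {n} {A M N : Term n} → IsA A → A ≼ M → M →v N → A ≼ N
IsA-≼-→v a p           (βv v)    = ⊥-elim (IsA-⋠-βv-redex a v p)
IsA-≼-→v a (≼-app p _) σ1        = ⊥-elim (IsB-⋠-redex (proj₁ (IsA-app⁻ a)) p)
IsA-≼-→v a p           (σ3 v)    = ⊥-elim (IsA-⋠-σ3-redex a v p)
IsA-≼-→v _ ≼-bot-lam   (ξlam _)  = ≼-bot-lam
IsA-≼-→v a (≼-lam p)   (ξlam r)  = ≼-lam (IsA-≼-→v (IsA-lam⁻ a) p r)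
IsA-≼-→v a (≼-app p q) (ξl r)    = ≼-app (IsA-≼-→v (fromB (proj₁ (IsA-app⁻ a))) p r) q
IsA-≼-→v a (≼-app p q) (ξr r)    = ≼-app p (IsA-≼-→v (proj₂ (IsA-app⁻ a)) q r)

lemma2p5 : (n : ℕ) (M N A : Term n) → InΛ M → InΛ N → IsA A →
           A ⊑ M → M →v N → A ⊑ N
lemma2p5 _ _ _ _ _ _ a p r = ≼⇒⊑ (IsA-≼-→v a (⊑⇒≼ p) r)
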